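{- Let $n$ be a positive integer and $C_n$ the cyclic group of order $n$. The cyclic vertex connectivity and the vertex connectivity of the power graph $\mathcal{P}(C_n)$ are not equal if one of the following holds: (i) $n$ is a power of a prime; (ii) $n = p_1p_2$ for some primes $p_1<p_2$ with $p_1 \leq 3$; (iii) $n = 4p$ for some odd prime $p$.
   Context: The power graph $\mathcal{P}(G)$ of a group $G$ is the simple undirected graph with vertex set $G$ in which two distinct vertices are adjacent if one of them is a positive power of the other. For a graph $\Gamma$, the vertex connectivity $\kappa(\Gamma)$ is the minimum number of vertices whose deletion either disconnects $\Gamma$ or reduces it to a trivial graph. A set $S$ of vertices is a cyclic vertex cutset if $\Gamma - S$ is disconnected and has at least two components each of which contains a cycle. The cyclic vertex connectivity $c\kappa(\Gamma)$ is the minimum cardinality of a cyclic vertex cutset of $\Gamma$, and is taken to be $\infty$ if no cyclic vertex cutset exists. -}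

module Defs where

open import Data.Nat using (ℕ; zero; suc; _+_; _*_; _≤_; _<_; NonZero)
open import Data.Nat.DivMod using (_%_)
open import Data.Nat.Primality using (Prime)
open import Data.Nat.Divisibility using (_∣_)
open import Data.Fin using (Fin; toℕ)
open import Data.Fin.Subset using (Subset; _∈_; _∉_; ∣_∣)
open import Data.List using (List; []; _∷_)
open import Data.List.Relation.Unary.All using (All)
open import Data.List.Relation.Unary.Unique.Propositional using (Unique)
open import Data.List.Relation.Unary.Linked using (Linked)
open import Data.Maybe using (Maybe; just; nothing)
open import Data.Product using (Σ; ∃; ∃-syntax; _×_; _,_)
open import Data.Sum using (_⊎_)
open import Relation.Nullary using (¬_)
open import Relation.Binary.PropositionalEquality using (_≡_; _≢_)

-- The cyclic group C_n is modelled as ℤ/nℤ = Fin n under addition mod n.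
-- In additive notation the k-th power of x is k·x (mod n).

IsPosPower : (n : ℕ) .{{_ : NonZero n}} → Fin n → Fin n → Set
IsPosPower n x y = ∃[ k ] (1 ≤ k × (k * toℕ x) % n ≡ toℕ y)

Adj : (n : ℕ) .{{_ : NonZero n}} → Fin n → Fin n → Set
Adj n x y = x ≢ y × (IsPosPower n x y ⊎ IsPosPower n y x)

data Reach (n : ℕ) .{{_ : NonZero n}} (S : Subset n) : Fin n → Fin n → Set where
  here : ∀ {x} → x ∉ S → Reach n S x x
  step : ∀ {x y z} → x ∉ S → Adj n x y → Reach n S y z → Reach n S x z

Disconnected : (n : ℕ) .{{_ : NonZero n}} → Subset n → Set
Disconnected n S = ∃[ u ] ∃[ v ] (u ∉ S × v ∉ S × ¬ Reach n S u v)

record Cycle (n : ℕ) .{{_ : NonZero n}} (S : Subset n) : Set where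
  constructor mkCycle
  field
    v₀ v₁ v₂ : Fin n
    rest     : List (Fin n)
    distinct : Unique (v₀ ∷ v₁ ∷ v₂ ∷ rest)
    avoid    : All (_∉ S) (v₀ ∷ v₁ ∷ v₂ ∷ rest)
    path     : Linked (Adj n) (v₀ ∷ v₁ ∷ v₂ ∷ rest)
    last     : Fin n
    isLast   : Data.List.last (v₂ ∷ rest) ≡ just last
    closing  : Adj n last v₀

open Cycle public

ComponentHasCycle : (n : ℕ) .{{_ : NonZero n}} → Subset n → Fin n → Set
ComponentHasCycle n S u = Σ (Cycle n S) λ c → Reach n S u (v₀ c)

-- Vertex cut in the sense of vertex connectivity: deletion disconnects
-- or reduces to the trivial (one-vertex) graph.
IsVertexCut : (n : ℕ) .{{_ : NonZero n}} → Subset n → Set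
IsVertexCut n S = Disconnected n S ⊎ (∣ S ∣ + 1 ≡ n)

IsCyclicVertexCut : (n : ℕ) .{{_ : NonZero n}} → Subset n → Set
IsCyclicVertexCut n S =
  ∃[ u ] ∃[ v ] (u ∉ S × v ∉ S × ¬ Reach n S u v
                 × ComponentHasCycle n S u × ComponentHasCycle n S v)

VertexConnectivityIs : (n : ℕ) .{{_ : NonZero n}} → ℕ → Set
VertexConnectivityIs n k =
  (∃[ S ] (IsVertexCut n S × ∣ S ∣ ≡ k)) × (∀ S → IsVertexCut n S → k ≤ ∣ S ∣)

-- cκ(P(C_n)) = c, where c = nothing encodes ∞ (no cyclic vertex cutset).
CyclicVertexConnectivityIs : (n : ℕ) .{{_ : NonZero n}} → Maybe ℕ → Set
CyclicVertexConnectivityIs n (just k) =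
  (∃[ S ] (IsCyclicVertexCut n S × ∣ S ∣ ≡ k)) × (∀ S → IsCyclicVertexCut n S → k ≤ ∣ S ∣)
CyclicVertexConnectivityIs n nothing = ∀ S → ¬ IsCyclicVertexCut n S

IsPrimePower : ℕ → Set
IsPrimePower n = ∃[ p ] ∃[ e ] (Prime p × 1 ≤ e × n ≡ p Data.Nat.^ e)

IsSmallSemiprime : ℕ → Set
IsSmallSemiprime n = ∃[ p₁ ] ∃[ p₂ ] (Prime p₁ × Prime p₂ × p₁ < p₂ × p₁ ≤ 3 × n ≡ p₁ * p₂)

IsFourOddPrime : ℕ → Set
IsFourOddPrime n = ∃[ p ] (Prime p × ¬ (2 ∣ p) × n ≡ 4 * p)

module Submission where

-- In ℤ/n the vertex y is a power of x iff gcd(x, n) ∣ y, so adjacency in P(C_n) is governed by the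
-- divisor lattice of n; in particular 0 and the generators are adjacent to everything and lie in
-- every disconnecting set.  For n = pᵉ the divisors form a chain, so P(C_n) is complete.  For
-- n = p₁p₂ with p₁ ≤ 3 the only nonzero multiples of p₂ are p₂ and 2p₂, so every cycle meets a
-- vertex prime to p₂; these have gcd dividing p₁ and are mutually adjacent, so no cyclic cutset
-- exists.  For n = 4p the same argument shows that a cyclic cutset S leaves a component built from
-- p, 2p, 3p; then S contains 2 and −2, and replacing them by 2p gives a smaller vertex cut, which
-- separates the odd multiples of p from the rest.

open import Defs
open import Data.Nat using (ℕ; zero; suc; _+_; _*_; _^_; _≤_; _<_; z≤n; s≤s; NonZero; >-nonZero⁻¹)
open import Data.Nat.Properties
  using (≤-trans; <-≤-trans; <⇒≱; n≢0⇒n>0; m≤n+m; +-comm; +-suc; +-monoʳ-≤; *-comm; *-assoc; *-identityʳ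
        ; *-distribʳ-+; *-monoʳ-≤; *-monoˡ-<; *-cancelʳ-<; *-cancelˡ-≡; m*n≢0; ∸-monoʳ-<; m∸n+n≡m; module ≤-Reasoning)
open import Data.Nat.DivMod using (_%_; [m+kn]%n≡m%n; m<n⇒m%n≡m; %-distribˡ-*; %-remove-+ʳ)
open import Data.Nat.Divisibility
open import Data.Nat.GCD using (gcd; gcd-GCD; gcd[m,n]∣m; gcd[m,n]∣n; gcd-greatest; module Bézout)
open import Data.Nat.Coprimality using (Coprime; coprime-divisor)
open import Data.Nat.Primality using (Prime; prime⇒irreducible; prime⇒nonZero; ¬prime[1]; prime[2]; euclidsLemma)
open import Data.Nat.Tactic.RingSolver using (solve-∀)
open import Data.Fin using (Fin; toℕ; fromℕ<; _≟_)
import Data.Fin as Fin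
open import Data.Fin.Properties using (toℕ<n; toℕ-injective; toℕ-fromℕ<)
open import Data.Fin.Subset using (Subset; _∈_; _∉_; inside; outside; _∪_; _-_; ⁅_⁆)
import Data.Fin.Subset as Subset
open import Data.Fin.Subset.Properties
  using (_∈?_; ∣p∣≤∣x∷p∣; x∈p∪q⁺; x∈p∪q⁻; x∈⁅x⁆; x∈⁅y⁆⇒x≡y; ∣⁅x⁆∣≡1; p─q⊆p; x∈p∧x≢y⇒x∈p-y; x∈p⇒∣p-x∣<∣p∣)
open import Data.Vec using ([]; _∷_)
open import Data.Vec.Base using (here; there)
open import Data.List.Relation.Unary.All using (_∷_)
open import Data.List.Relation.Unary.AllPairs using (_∷_)
open import Data.List.Relation.Unary.Linked using (_∷_)
open import Data.Maybe using (Maybe; just)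
open import Data.Product using (∃-syntax; _×_; _,_; proj₂)
open import Data.Sum using (_⊎_; inj₁; inj₂; [_,_]′)
open import Data.Empty using (⊥; ⊥-elim)
open import Function using (_∘_)
open import Relation.Nullary using (¬_; yes; no)
open import Relation.Binary.PropositionalEquality

¬3-distinct-in-pair : ∀ {A : Set} {a b c X Y : A}
  → a ≡ X ⊎ a ≡ Y → b ≡ X ⊎ b ≡ Y → c ≡ X ⊎ c ≡ Y → a ≢ b → a ≢ c → b ≢ c → ⊥
¬3-distinct-in-pair (inj₁ refl) (inj₁ refl) _ a≢b _ _ = a≢b refl
¬3-distinct-in-pair (inj₂ refl) (inj₂ refl) _ a≢b _ _ = a≢b refl
¬3-distinct-in-pair (inj₁ refl) _ (inj₁ refl) _ a≢c _ = a≢c refl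
¬3-distinct-in-pair (inj₂ refl) _ (inj₂ refl) _ a≢c _ = a≢c refl
¬3-distinct-in-pair _ (inj₁ refl) (inj₁ refl) _ _ b≢c = b≢c refl
¬3-distinct-in-pair _ (inj₂ refl) (inj₂ refl) _ _ b≢c = b≢c refl

∤⇒coprime : ∀ {p d} → Prime p → ¬ p ∣ d → Coprime d p
∤⇒coprime p-prime p∤d (c∣d , c∣p) with prime⇒irreducible p-prime c∣p
... | inj₁ c≡1 = c≡1
... | inj₂ refl = ⊥-elim (p∤d c∣d)

∤∧∣p^e⇒≡1 : ∀ {p d} → Prime p → ∀ e → ¬ p ∣ d → d ∣ p ^ e → d ≡ 1
∤∧∣p^e⇒≡1 p-prime zero    p∤d d∣1   = ∣1⇒≡1 d∣1
∤∧∣p^e⇒≡1 p-prime (suc e) p∤d d∣p^e = ∤∧∣p^e⇒≡1 p-prime e p∤d (coprime-divisor (∤⇒coprime p-prime p∤d) d∣p^e)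

∣p^e-total : ∀ {p} → Prime p → ∀ e {d₁ d₂} → d₁ ∣ p ^ e → d₂ ∣ p ^ e → d₁ ∣ d₂ ⊎ d₂ ∣ d₁
∣p^e-total p-prime zero {d₂ = d₂} d₁∣1 _ = inj₁ (subst (_∣ d₂) (sym (∣1⇒≡1 d₁∣1)) (1∣ d₂))
∣p^e-total {p} p-prime (suc e) {d₁} {d₂} d₁∣ d₂∣ with p ∣? d₁ | p ∣? d₂
... | no p∤d₁ | _ = inj₁ (subst (_∣ d₂) (sym (∤∧∣p^e⇒≡1 p-prime (suc e) p∤d₁ d₁∣)) (1∣ d₂))
... | yes _ | no p∤d₂ = inj₂ (subst (_∣ d₁) (sym (∤∧∣p^e⇒≡1 p-prime (suc e) p∤d₂ d₂∣)) (1∣ d₁))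
... | yes (divides q₁ refl) | yes (divides q₂ refl)
  with ∣p^e-total p-prime e (cancel q₁ d₁∣) (cancel q₂ d₂∣)
  where
  cancel : ∀ q → q * p ∣ p * p ^ e → q ∣ p ^ e
  cancel q = *-cancelʳ-∣ p {{prime⇒nonZero p-prime}} ∘ subst (q * p ∣_) (*-comm p (p ^ e))
...   | inj₁ q₁∣q₂ = inj₁ (*-monoˡ-∣ p q₁∣q₂)
...   | inj₂ q₂∣q₁ = inj₂ (*-monoˡ-∣ p q₂∣q₁)

-- ℕ-Bézout gives g + b n ≡ a m or g + a m ≡ b n; in the second case (n − 1) a is a multiplier.
gcd-multiplier : ∀ m n .{{_ : NonZero n}} → ∃[ a ] (a * m) % n ≡ gcd m n % n
gcd-multiplier m n@(suc k) with Bézout.identity (gcd-GCD m n)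
... | Bézout.+- a b g+bn≡am = a , (begin
  (a * m) % n           ≡⟨ cong (_% n) g+bn≡am ⟨
  (gcd m n + b * n) % n ≡⟨ [m+kn]%n≡m%n (gcd m n) b n ⟩
  gcd m n % n           ∎)
  where open ≡-Reasoning
... | Bézout.-+ a b g+am≡bn = k * a , (begin
  (k * a * m) % n               ≡⟨ [m+kn]%n≡m%n (k * a * m) b n ⟨
  (k * a * m + b * n) % n       ≡⟨ cong (λ t → (k * a * m + t) % n) g+am≡bn ⟨
  (k * a * m + (g + a * m)) % n ≡⟨ cong (_% n) (shift k a m g) ⟩
  (g + a * m * n) % n           ≡⟨ [m+kn]%n≡m%n g (a * m) n ⟩
  g % n                         ∎)
  where
  open ≡-Reasoning
  g = gcd m n
  shift : ∀ k a m g → k * a * m + (g + a * m) ≡ g + a * m * suc k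
  shift = solve-∀

∣p∪q∣≤∣p∣+∣q∣ : ∀ {n} (p q : Subset n) → Subset.∣ p ∪ q ∣ ≤ Subset.∣ p ∣ + Subset.∣ q ∣
∣p∪q∣≤∣p∣+∣q∣ []            []            = z≤n
∣p∪q∣≤∣p∣+∣q∣ (inside  ∷ p) (s ∷ q)       = s≤s (≤-trans (∣p∪q∣≤∣p∣+∣q∣ p q) (+-monoʳ-≤ _ (∣p∣≤∣x∷p∣ s q)))
∣p∪q∣≤∣p∣+∣q∣ (outside ∷ p) (outside ∷ q) = ∣p∪q∣≤∣p∣+∣q∣ p q
∣p∪q∣≤∣p∣+∣q∣ (outside ∷ p) (inside  ∷ q) =
  subst (Subset.∣ p ∪ q ∣ <_) (sym (+-suc Subset.∣ p ∣ Subset.∣ q ∣)) (s≤s (∣p∪q∣≤∣p∣+∣q∣ p q))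

x∉p-x : ∀ {n} (p : Subset n) x → x ∉ p - x
x∉p-x (_ ∷ p) Fin.zero    ()
x∉p-x (_ ∷ p) (Fin.suc x) (there x∈p-x) = x∉p-x p x x∈p-x

module PowerGraph (n : ℕ) .{{_ : NonZero n}} where

  -- ⟨x⟩ = ⟨gcd x n⟩ in ℤ/n, so y is a power of x exactly when gcd x n ∣ y.
  gcdₙ : Fin n → ℕ
  gcdₙ x = gcd (toℕ x) n

  gcdₙ∣n : ∀ x → gcdₙ x ∣ n
  gcdₙ∣n x = gcd[m,n]∣n (toℕ x) n

  gcdₙ∣x : ∀ x → gcdₙ x ∣ toℕ x
  gcdₙ∣x x = gcd[m,n]∣m (toℕ x) n

  -- The exponent t a + n is positive even when y = 0.
  gcdₙ∣⇒IsPosPower : ∀ x y → gcdₙ x ∣ toℕ y → IsPosPower n x y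
  gcdₙ∣⇒IsPosPower x y (divides t y≡tg) with gcd-multiplier (toℕ x) n
  ... | a , ax≡g = t * a + n , ≤-trans (>-nonZero⁻¹ n) (m≤n+m n (t * a)) , (begin
    ((t * a + n) * toℕ x) % n              ≡⟨ cong (_% n) (*-distribʳ-+ (toℕ x) (t * a) n) ⟩
    (t * a * toℕ x + n * toℕ x) % n        ≡⟨ %-remove-+ʳ (t * a * toℕ x) (m∣m*n (toℕ x)) ⟩
    (t * a * toℕ x) % n                    ≡⟨ cong (_% n) (*-assoc t a (toℕ x)) ⟩
    (t * (a * toℕ x)) % n                  ≡⟨ %-distribˡ-* t (a * toℕ x) n ⟩
    ((t % n) * ((a * toℕ x) % n)) % n      ≡⟨ cong (λ r → ((t % n) * r) % n) ax≡g ⟩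
    ((t % n) * (gcdₙ x % n)) % n           ≡⟨ %-distribˡ-* t (gcdₙ x) n ⟨
    (t * gcdₙ x) % n                       ≡⟨ cong (_% n) y≡tg ⟨
    toℕ y % n                              ≡⟨ m<n⇒m%n≡m (toℕ<n y) ⟩
    toℕ y                                  ∎)
    where open ≡-Reasoning

  IsPosPower⇒gcdₙ∣ : ∀ x y → IsPosPower n x y → gcdₙ x ∣ toℕ y
  IsPosPower⇒gcdₙ∣ x y (k , _ , kx%n≡y) =
    subst (gcdₙ x ∣_) kx%n≡y (%-presˡ-∣ (∣-trans (gcdₙ∣x x) (n∣m*n k)) (gcdₙ∣n x))

  Adj-sym : ∀ {x y} → Adj n x y → Adj n y x
  Adj-sym (x≢y , inj₁ y=xᵏ) = x≢y ∘ sym , inj₂ y=xᵏ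
  Adj-sym (x≢y , inj₂ x=yᵏ) = x≢y ∘ sym , inj₁ x=yᵏ

  module _ {S : Subset n} where

    Reach-start : ∀ {x y} → Reach n S x y → x ∉ S
    Reach-start (here x∉S)     = x∉S
    Reach-start (step x∉S _ _) = x∉S

    Reach-end : ∀ {x y} → Reach n S x y → y ∉ S
    Reach-end (here x∉S)   = x∉S
    Reach-end (step _ _ r) = Reach-end r

    Reach-trans : ∀ {x y z} → Reach n S x y → Reach n S y z → Reach n S x z
    Reach-trans (here _)         r′ = r′
    Reach-trans (step x∉S x~y r) r′ = step x∉S x~y (Reach-trans r r′)

    Reach-sym : ∀ {x y} → Reach n S x y → Reach n S y x
    Reach-sym (here x∉S)       = here x∉S
    Reach-sym (step x∉S x~y r) = Reach-trans (Reach-sym r) (step (Reach-start r) (Adj-sym x~y) (here x∉S))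

    gcdₙ∣⇒Reach : ∀ {x y} → x ∉ S → y ∉ S → gcdₙ x ∣ toℕ y → Reach n S x y
    gcdₙ∣⇒Reach {x} {y} x∉S y∉S g∣y with x ≟ y
    ... | yes refl = here x∉S
    ... | no x≢y   = step x∉S (x≢y , inj₁ (gcdₙ∣⇒IsPosPower x y g∣y)) (here y∉S)

    comparable⇒Reach : ∀ {x y} → x ∉ S → y ∉ S → gcdₙ x ∣ gcdₙ y ⊎ gcdₙ y ∣ gcdₙ x → Reach n S x y
    comparable⇒Reach {x} {y} x∉S y∉S (inj₁ gx∣gy) = gcdₙ∣⇒Reach x∉S y∉S (∣-trans gx∣gy (gcdₙ∣x y))
    comparable⇒Reach {x} {y} x∉S y∉S (inj₂ gy∣gx) =
      Reach-sym (gcdₙ∣⇒Reach y∉S x∉S (∣-trans gy∣gx (gcdₙ∣x x)))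

    IsCyclicVertexCut⇒Disconnected : IsCyclicVertexCut n S → Disconnected n S
    IsCyclicVertexCut⇒Disconnected (u , v , u∉S , v∉S , u↛v , _) = u , v , u∉S , v∉S , u↛v

    hub⇒¬Disconnected : ∀ {h} → (∀ {x} → x ∉ S → Reach n S h x) → ¬ Disconnected n S
    hub⇒¬Disconnected h⇝ (u , v , u∉S , v∉S , u↛v) = u↛v (Reach-trans (Reach-sym (h⇝ u∉S)) (h⇝ v∉S))

    -- 0 is a power of every vertex.
    Disconnected⇒toℕ≢0 : Disconnected n S → ∀ {x} → x ∉ S → toℕ x ≢ 0
    Disconnected⇒toℕ≢0 disc {x} x∉S x≡0 = hub⇒¬Disconnected x⇝ disc
      where
      x⇝ : ∀ {y} → y ∉ S → Reach n S x y
      x⇝ y∉S = Reach-sym (gcdₙ∣⇒Reach y∉S x∉S (subst (_ ∣_) (sym x≡0) (_ ∣0)))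

    -- A generator has every vertex as a power.
    Disconnected⇒gcdₙ≢1 : Disconnected n S → ∀ {x} → x ∉ S → gcdₙ x ≢ 1
    Disconnected⇒gcdₙ≢1 disc {x} x∉S g≡1 =
      hub⇒¬Disconnected (λ y∉S → gcdₙ∣⇒Reach x∉S y∉S (subst (_∣ _) (sym g≡1) (1∣ _))) disc

    primePower⇒¬Disconnected : IsPrimePower n → ¬ Disconnected n S
    primePower⇒¬Disconnected (p , e , p-prime , _ , n≡pᵉ) (u , v , u∉S , v∉S , u↛v) =
      u↛v (comparable⇒Reach u∉S v∉S (∣p^e-total p-prime e (divides-pᵉ u) (divides-pᵉ v)))
      where
      divides-pᵉ : ∀ x → gcdₙ x ∣ p ^ e
      divides-pᵉ x = subst (gcdₙ x ∣_) n≡pᵉ (gcdₙ∣n x)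

    record Triad (u : Fin n) : Set where
      field
        {x y z}   : Fin n
        x≢y       : x ≢ y
        x≢z       : x ≢ z
        y≢z       : y ≢ z
        u⇝x       : Reach n S u x
        u⇝y       : Reach n S u y
        u⇝z       : Reach n S u z

    cycle⇒triad : ∀ {u} → ComponentHasCycle n S u → Triad u
    cycle⇒triad (mkCycle v₀ v₁ v₂ _ ((v₀≢v₁ ∷ v₀≢v₂ ∷ _) ∷ (v₁≢v₂ ∷ _) ∷ _) (v₀∉S ∷ v₁∉S ∷ v₂∉S ∷ _)
                         (v₀~v₁ ∷ v₁~v₂ ∷ _) _ _ _ , u⇝v₀) =
      record { x≢y = v₀≢v₁ ; x≢z = v₀≢v₂ ; y≢z = v₁≢v₂ ; u⇝x = u⇝v₀ ; u⇝y = u⇝v₁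
             ; u⇝z = Reach-trans u⇝v₁ (step v₁∉S v₁~v₂ (here v₂∉S)) }
      where
      u⇝v₁ = Reach-trans u⇝v₀ (step v₀∉S v₀~v₁ (here v₁∉S))

    ComponentHasNonMultiple : ℕ → Fin n → Set
    ComponentHasNonMultiple q u = ∃[ a ] (Reach n S u a × ¬ q ∣ toℕ a)

    -- If n = pᵉ q, the vertices prime to q have gcdₙ dividing pᵉ, so they are pairwise adjacent.
    nonMultiples-connected : ∀ {p e q} → Prime p → Prime q → n ≡ p ^ e * q → ∀ {u v}
      → ComponentHasNonMultiple q u → ComponentHasNonMultiple q v → Reach n S u v
    nonMultiples-connected {p} {e} {q} p-prime q-prime n≡pᵉq (a , u⇝a , q∤a) (b , v⇝b , q∤b) =
      Reach-trans u⇝a (Reach-trans a⇝b (Reach-sym v⇝b))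
      where
      divides-pᵉ : ∀ {x} → ¬ q ∣ toℕ x → gcdₙ x ∣ p ^ e
      divides-pᵉ {x} q∤x = coprime-divisor (∤⇒coprime q-prime (λ q∣g → q∤x (∣-trans q∣g (gcdₙ∣x x))))
        (subst (gcdₙ x ∣_) (trans n≡pᵉq (*-comm (p ^ e) q)) (gcdₙ∣n x))
      a⇝b = comparable⇒Reach (Reach-end u⇝a) (Reach-end v⇝b)
              (∣p^e-total p-prime e (divides-pᵉ q∤a) (divides-pᵉ q∤b))

    triad-∤⊎∣ : ∀ {u} (t : Triad u) q → let open Triad t in
      ComponentHasNonMultiple q u ⊎ (q ∣ toℕ x × q ∣ toℕ y × q ∣ toℕ z)
    triad-∤⊎∣ t q with q ∣? toℕ (Triad.x t) | q ∣? toℕ (Triad.y t) | q ∣? toℕ (Triad.z t)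
    ... | no q∤x  | _       | _       = inj₁ (_ , Triad.u⇝x t , q∤x)
    ... | yes _   | no q∤y  | _       = inj₁ (_ , Triad.u⇝y t , q∤y)
    ... | yes _   | yes _   | no q∤z  = inj₁ (_ , Triad.u⇝z t , q∤z)
    ... | yes q∣x | yes q∣y | yes q∣z = inj₂ (q∣x , q∣y , q∣z)

    multiple-quotient : ∀ {m q} → n ≡ m * q → Disconnected n S → ∀ {x} → x ∉ S → q ∣ toℕ x
      → ∃[ j ] (toℕ x ≡ j * q × 0 < j × j < m)
    multiple-quotient {m} {q} n≡mq disc {x} x∉S (divides j x≡jq) = j , x≡jq , 0<j , j<m
      where
      0<j : 0 < j
      0<j = n≢0⇒n>0 (λ j≡0 → Disconnected⇒toℕ≢0 disc x∉S (trans x≡jq (cong (_* q) j≡0)))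
      j<m : j < m
      j<m = *-cancelʳ-< q j m (subst₂ _<_ x≡jq n≡mq (toℕ<n x))

    smallSemiprime⇒¬CyclicVertexCut : IsSmallSemiprime n → ¬ IsCyclicVertexCut n S
    smallSemiprime⇒¬CyclicVertexCut (p₁ , p₂ , p₁-prime , p₂-prime , _ , p₁≤3 , n≡p₁p₂)
                                     cut@(_ , _ , _ , _ , u↛v , u-cycle , v-cycle) =
      u↛v (nonMultiples-connected {e = 1} p₁-prime p₂-prime n≡p₁¹p₂
             (nonMultiple u-cycle) (nonMultiple v-cycle))
      where
      n≡p₁¹p₂ : n ≡ p₁ ^ 1 * p₂
      n≡p₁¹p₂ = trans n≡p₁p₂ (cong (_* p₂) (sym (*-identityʳ p₁)))
      p₂-multiple : ∀ {x} → x ∉ S → p₂ ∣ toℕ x → toℕ x ≡ 1 * p₂ ⊎ toℕ x ≡ 2 * p₂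
      p₂-multiple x∉S p₂∣x with multiple-quotient n≡p₁p₂ (IsCyclicVertexCut⇒Disconnected cut) x∉S p₂∣x
      ... | 1 , x≡p₂ , _ , _ = inj₁ x≡p₂
      ... | 2 , x≡2p₂ , _ , _ = inj₂ x≡2p₂
      ... | suc (suc (suc _)) , _ , _ , j<p₁ = ⊥-elim (<⇒≱ j<p₁ (≤-trans p₁≤3 (s≤s (s≤s (s≤s z≤n)))))
      -- Outside S the multiples of p₂ are only p₂ and 2 p₂, too few for the three vertices of a cycle.
      nonMultiple : ∀ {w} → ComponentHasCycle n S w → ComponentHasNonMultiple p₂ w
      nonMultiple w-cycle with cycle⇒triad w-cycle
      ... | t with triad-∤⊎∣ t p₂
      ...   | inj₁ a = a
      ...   | inj₂ (p₂∣x , p₂∣y , p₂∣z) = ⊥-elim (¬3-distinct-in-pair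
                (p₂-multiple (Reach-end u⇝x) p₂∣x) (p₂-multiple (Reach-end u⇝y) p₂∣y)
                (p₂-multiple (Reach-end u⇝z) p₂∣z)
                (x≢y ∘ toℕ-injective) (x≢z ∘ toℕ-injective) (y≢z ∘ toℕ-injective))
        where open Triad t

module FourTimesOddPrime {p : ℕ} (p-prime : Prime p) (p-odd : ¬ 2 ∣ p) where

  private instance
    p≢0 : NonZero p
    p≢0 = prime⇒nonZero p-prime
    4p≢0 : NonZero (4 * p)
    4p≢0 = m*n≢0 4 p

  open PowerGraph (4 * p)

  p≢1 : p ≢ 1
  p≢1 p≡1 = ¬prime[1] (subst Prime p≡1 p-prime)

  p∤2 : ¬ p ∣ 2
  p∤2 p∣2 with prime⇒irreducible prime[2] p∣2
  ... | inj₁ p≡1 = p≢1 p≡1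
  ... | inj₂ refl = p-odd ∣-refl

  2∤1 : ¬ 2 ∣ 1
  2∤1 2∣1 with () ← ∣1⇒≡1 2∣1

  2∤3 : ¬ 2 ∣ 3
  2∤3 2∣3 = 2∤1 (∣m+n∣m⇒∣n 2∣3 ∣-refl)

  odd-multiple : ∀ {y} → y ≡ 1 * p ⊎ y ≡ 3 * p → ¬ 2 ∣ y
  odd-multiple y≡jp 2∣y with y≡jp
  ... | inj₁ refl = [ 2∤1 , p-odd ]′ (euclidsLemma 1 p prime[2] 2∣y)
  ... | inj₂ refl = [ 2∤3 , p-odd ]′ (euclidsLemma 3 p prime[2] 2∣y)

  2∣4p : 2 ∣ 4 * p
  2∣4p = divides (2 * p) (trans (*-assoc 2 2 p) (*-comm 2 (2 * p)))

  1≤p : 1 ≤ p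
  1≤p = >-nonZero⁻¹ p

  2≤4p : 2 ≤ 4 * p
  2≤4p = ≤-trans (s≤s (s≤s z≤n)) (*-monoʳ-≤ 4 1≤p)

  twoP two −two : Fin (4 * p)
  twoP = fromℕ< (*-monoˡ-< p {2} {4} (s≤s (s≤s (s≤s z≤n))))
  two  = fromℕ< (<-≤-trans (s≤s (s≤s (s≤s z≤n))) (*-monoʳ-≤ 4 1≤p))
  −two = fromℕ< (∸-monoʳ-< {o = 0} (s≤s z≤n) 2≤4p)

  toℕ-twoP : toℕ twoP ≡ 2 * p
  toℕ-twoP = toℕ-fromℕ< _

  toℕ-two : toℕ two ≡ 2
  toℕ-two = toℕ-fromℕ< _

  toℕ-−two+2 : toℕ −two + 2 ≡ 4 * p
  toℕ-−two+2 = trans (cong (_+ 2) (toℕ-fromℕ< _)) (m∸n+n≡m 2≤4p)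

  gcdₙ-two∣2 : gcdₙ two ∣ 2
  gcdₙ-two∣2 = subst (gcdₙ two ∣_) toℕ-two (gcdₙ∣x two)

  gcdₙ-−two∣2 : gcdₙ −two ∣ 2
  gcdₙ-−two∣2 = ∣m+n∣m⇒∣n (subst (gcdₙ −two ∣_) (sym toℕ-−two+2) (gcdₙ∣n −two)) (gcdₙ∣x −two)

  2∣two : 2 ∣ toℕ two
  2∣two = subst (2 ∣_) (sym toℕ-two) ∣-refl

  2∣−two : 2 ∣ toℕ −two
  2∣−two = ∣m+n∣m⇒∣n (subst (2 ∣_) (trans (sym toℕ-−two+2) (+-comm (toℕ −two) 2)) 2∣4p) ∣-refl

  two≢twoP : two ≢ twoP
  two≢twoP two≡twoP =
    p≢1 (sym (*-cancelˡ-≡ 1 p 2 (trans (sym toℕ-two) (trans (cong toℕ two≡twoP) toℕ-twoP))))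

  two≢−two : two ≢ −two
  two≢−two two≡−two = p≢1 (sym (*-cancelˡ-≡ 1 p 4 (begin
    4                ≡⟨ cong (_+ 2) toℕ-two ⟨
    toℕ two + 2      ≡⟨ cong (λ x → toℕ x + 2) two≡−two ⟩
    toℕ −two + 2     ≡⟨ toℕ-−two+2 ⟩
    4 * p            ∎)))
    where open ≡-Reasoning

  OddMultiple : Fin (4 * p) → Set
  OddMultiple x = p ∣ toℕ x × ¬ 2 ∣ toℕ x

  2∣twoP : 2 ∣ toℕ twoP
  2∣twoP = subst (2 ∣_) (sym toℕ-twoP) (m∣m*n p)

  gcdₙ∣2⇒p∤ : ∀ {w} → gcdₙ w ∣ 2 → ¬ p ∣ toℕ w
  gcdₙ∣2⇒p∤ g∣2 p∣w = p∤2 (∣-trans (gcd-greatest p∣w (n∣m*n 4)) g∣2)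

  module _ {S : Subset (4 * p)} (disc : Disconnected (4 * p) S) where

    p-multiple : ∀ {y} → y ∉ S → p ∣ toℕ y → toℕ y ≡ 2 * p ⊎ (toℕ y ≡ 1 * p ⊎ toℕ y ≡ 3 * p)
    p-multiple y∉S p∣y with multiple-quotient {m = 4} {q = p} refl disc y∉S p∣y
    ... | 1 , y≡p  , _ , _ = inj₂ (inj₁ y≡p)
    ... | 2 , y≡2p , _ , _ = inj₁ y≡2p
    ... | 3 , y≡3p , _ , _ = inj₂ (inj₂ y≡3p)
    ... | suc (suc (suc (suc _))) , _ , _ , s≤s (s≤s (s≤s (s≤s ())))

    even-p-multiple≡twoP : ∀ {y} → y ∉ S → p ∣ toℕ y → 2 ∣ toℕ y → y ≡ twoP
    even-p-multiple≡twoP y∉S p∣y 2∣y with p-multiple y∉S p∣y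
    ... | inj₁ y≡2p  = toℕ-injective (trans y≡2p (sym toℕ-twoP))
    ... | inj₂ y≡odd = ⊥-elim (odd-multiple y≡odd 2∣y)

    -- Otherwise gcdₙ y is prime to p and odd, hence 1, and y would be a generator outside S.
    oddGcd⇒p∣ : ∀ {y} → y ∉ S → ¬ 2 ∣ gcdₙ y → p ∣ toℕ y
    oddGcd⇒p∣ {y} y∉S 2∤g with p ∣? toℕ y
    ... | yes p∣y = p∣y
    ... | no p∤y = ⊥-elim (Disconnected⇒gcdₙ≢1 disc y∉S (∣1⇒≡1 g∣1))
      where
      g∣4 : gcdₙ y ∣ 2 * 2
      g∣4 = coprime-divisor (∤⇒coprime p-prime (λ p∣g → p∤y (∣-trans p∣g (gcdₙ∣x y))))
              (subst (gcdₙ y ∣_) (*-comm 4 p) (gcdₙ∣n y))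
      g∣1 : gcdₙ y ∣ 1
      g∣1 = coprime-divisor (∤⇒coprime prime[2] 2∤g) (coprime-divisor (∤⇒coprime prime[2] 2∤g) g∣4)

    -- If some w ∉ S had gcdₙ w ∣ 2, every vertex outside S would be joined to 2p, directly or through w.
    gcdₙ∣2⇒∈S : twoP ∉ S → ∀ {w} → gcdₙ w ∣ 2 → w ∈ S
    gcdₙ∣2⇒∈S twoP∉S {w} g∣2 with w ∈? S
    ... | yes w∈S = w∈S
    ... | no w∉S  = ⊥-elim (hub⇒¬Disconnected (twoP⇝ w∉S g∣2) disc)
      where
      twoP⇝ : ∀ {w} → w ∉ S → gcdₙ w ∣ 2 → ∀ {x} → x ∉ S → Reach (4 * p) S twoP x
      twoP⇝ {w} w∉S g∣2 {x} x∉S with 2 ∣? toℕ x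
      ... | yes 2∣x = Reach-trans (Reach-sym (gcdₙ∣⇒Reach w∉S twoP∉S (∣-trans g∣2 2∣twoP)))
                                  (gcdₙ∣⇒Reach w∉S x∉S (∣-trans g∣2 2∣x))
      ... | no 2∤x  = Reach-sym (gcdₙ∣⇒Reach x∉S twoP∉S (subst (gcdₙ x ∣_) (sym toℕ-twoP) gₓ∣2p))
        where
        gₓ∣2p : gcdₙ x ∣ 2 * p
        gₓ∣2p = coprime-divisor (∤⇒coprime prime[2] (λ 2∣g → 2∤x (∣-trans 2∣g (gcdₙ∣x x))))
                  (subst (gcdₙ x ∣_) (*-assoc 2 2 p) (gcdₙ∣n x))

    -- Three distinct multiples of p outside S must be p, 2p and 3p.
    cycle⇒nonMultiple⊎twoP : ∀ {u} → ComponentHasCycle (4 * p) S u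
      → ComponentHasNonMultiple p u ⊎ (twoP ∉ S × ∃[ a ] (Reach (4 * p) S u a × OddMultiple a))
    cycle⇒nonMultiple⊎twoP u-cycle with cycle⇒triad u-cycle
    ... | t with triad-∤⊎∣ t p
    ...   | inj₁ u-non = inj₁ u-non
    ...   | inj₂ (p∣x , p∣y , p∣z) = inj₂ (twoP∉S , oddVertex)
      where
      open Triad t
      values : ∀ {y} → Reach (4 * p) S _ y → p ∣ toℕ y
        → toℕ y ≡ 2 * p ⊎ (toℕ y ≡ 1 * p ⊎ toℕ y ≡ 3 * p)
      values u⇝y = p-multiple (Reach-end u⇝y)
      ≡2p⇒twoP∉S : ∀ {y} → y ∉ S → toℕ y ≡ 2 * p → twoP ∉ S
      ≡2p⇒twoP∉S y∉S y≡2p = subst (_∉ S) (toℕ-injective (trans y≡2p (sym toℕ-twoP))) y∉S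
      twoP∉S : twoP ∉ S
      twoP∉S with values u⇝x p∣x | values u⇝y p∣y | values u⇝z p∣z
      ... | inj₁ x≡2p | _ | _ = ≡2p⇒twoP∉S (Reach-end u⇝x) x≡2p
      ... | _ | inj₁ y≡2p | _ = ≡2p⇒twoP∉S (Reach-end u⇝y) y≡2p
      ... | _ | _ | inj₁ z≡2p = ≡2p⇒twoP∉S (Reach-end u⇝z) z≡2p
      ... | inj₂ x-odd | inj₂ y-odd | inj₂ z-odd = ⊥-elim
        (¬3-distinct-in-pair x-odd y-odd z-odd
          (x≢y ∘ toℕ-injective) (x≢z ∘ toℕ-injective) (y≢z ∘ toℕ-injective))
      oddVertex : ∃[ a ] (Reach (4 * p) S _ a × OddMultiple a)
      oddVertex with values u⇝x p∣x | values u⇝y p∣y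
      ... | inj₂ x-odd | _          = _ , u⇝x , p∣x , odd-multiple x-odd
      ... | inj₁ _     | inj₂ y-odd = _ , u⇝y , p∣y , odd-multiple y-odd
      ... | inj₁ x≡2p  | inj₁ y≡2p  = ⊥-elim (x≢y (toℕ-injective (trans x≡2p (sym y≡2p))))

  -- Trading the generators 2 and −2 of the subgroup of order 2p for the vertex 2p still
  -- separates the odd multiples of p from the rest.
  module Exchange {S : Subset (4 * p)} (disc : Disconnected (4 * p) S) (twoP∉S : twoP ∉ S) where

    T : Subset (4 * p)
    T = (S - two - −two) ∪ ⁅ twoP ⁆

    ∣T∣<∣S∣ : Subset.∣ T ∣ < Subset.∣ S ∣
    ∣T∣<∣S∣ = begin-strict
      Subset.∣ T ∣                                       ≤⟨ ∣p∪q∣≤∣p∣+∣q∣ (S - two - −two) ⁅ twoP ⁆ ⟩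
      Subset.∣ S - two - −two ∣ + Subset.∣ ⁅ twoP ⁆ ∣  ≡⟨ cong (Subset.∣ S - two - −two ∣ +_) (∣⁅x⁆∣≡1 twoP) ⟩
      Subset.∣ S - two - −two ∣ + 1                     ≡⟨ +-comm Subset.∣ S - two - −two ∣ 1 ⟩
      suc Subset.∣ S - two - −two ∣                     ≤⟨ x∈p⇒∣p-x∣<∣p∣ −two∈S-two ⟩
      Subset.∣ S - two ∣                                <⟨ x∈p⇒∣p-x∣<∣p∣ two∈S ⟩
      Subset.∣ S ∣                                      ∎
      where
      open ≤-Reasoning
      two∈S = gcdₙ∣2⇒∈S disc twoP∉S gcdₙ-two∣2
      −two∈S-two = x∈p∧x≢y⇒x∈p-y (gcdₙ∣2⇒∈S disc twoP∉S gcdₙ-−two∣2) (two≢−two ∘ sym)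

    ∉T⇒≢twoP : ∀ {y} → y ∉ T → y ≢ twoP
    ∉T⇒≢twoP y∉T refl = y∉T (x∈p∪q⁺ (inj₂ (x∈⁅x⁆ twoP)))

    ∉T⇒∉S : ∀ {y} → y ∉ T → y ≢ two → y ≢ −two → y ∉ S
    ∉T⇒∉S y∉T y≢two y≢−two y∈S =
      y∉T (x∈p∪q⁺ (inj₁ (x∈p∧x≢y⇒x∈p-y (x∈p∧x≢y⇒x∈p-y y∈S y≢two) y≢−two)))

    ∉S⇒∉T : ∀ {y} → y ∉ S → y ≢ twoP → y ∉ T
    ∉S⇒∉T y∉S y≢twoP y∈T with x∈p∪q⁻ (S - two - −two) ⁅ twoP ⁆ y∈T
    ... | inj₁ y∈S-two-−two = y∉S (p─q⊆p S _ (p─q⊆p (S - two) _ y∈S-two-−two))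
    ... | inj₂ y∈⁅twoP⁆     = y≢twoP (x∈⁅y⁆⇒x≡y twoP y∈⁅twoP⁆)

    two∉T : two ∉ T
    two∉T two∈T with x∈p∪q⁻ (S - two - −two) ⁅ twoP ⁆ two∈T
    ... | inj₁ two∈S-two-−two = x∉p-x S two (p─q⊆p (S - two) _ two∈S-two-−two)
    ... | inj₂ two∈⁅twoP⁆     = two≢twoP (x∈⁅y⁆⇒x≡y twoP two∈⁅twoP⁆)

    Adj-preserves-OddMultiple : ∀ {x y} → OddMultiple x → Adj (4 * p) x y → y ∉ T → OddMultiple y
    Adj-preserves-OddMultiple {x} {y} (p∣x , _) (_ , inj₁ y=xᵏ) y∉T = p∣y , 2∤y
      where
      p∣y : p ∣ toℕ y
      p∣y = ∣-trans (gcd-greatest p∣x (n∣m*n 4)) (IsPosPower⇒gcdₙ∣ x y y=xᵏ)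
      y∉S : y ∉ S
      y∉S = ∉T⇒∉S y∉T (λ y≡two → gcdₙ∣2⇒p∤ gcdₙ-two∣2 (subst (λ z → p ∣ toℕ z) y≡two p∣y))
                       (λ y≡−two → gcdₙ∣2⇒p∤ gcdₙ-−two∣2 (subst (λ z → p ∣ toℕ z) y≡−two p∣y))
      2∤y : ¬ 2 ∣ toℕ y
      2∤y 2∣y = ∉T⇒≢twoP y∉T (even-p-multiple≡twoP disc y∉S p∣y 2∣y)
    Adj-preserves-OddMultiple {x} {y} (_ , 2∤x) (_ , inj₂ x=yᵏ) y∉T = oddGcd⇒p∣ disc y∉S 2∤g , 2∤y
      where
      2∤g : ¬ 2 ∣ gcdₙ y
      2∤g 2∣g = 2∤x (∣-trans 2∣g (IsPosPower⇒gcdₙ∣ y x x=yᵏ))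
      2∤y : ¬ 2 ∣ toℕ y
      2∤y 2∣y = 2∤g (gcd-greatest 2∣y 2∣4p)
      y∉S : y ∉ S
      y∉S = ∉T⇒∉S y∉T (λ y≡two → 2∤y (subst (λ z → 2 ∣ toℕ z) (sym y≡two) 2∣two))
                       (λ y≡−two → 2∤y (subst (λ z → 2 ∣ toℕ z) (sym y≡−two) 2∣−two))

    Reach-preserves-OddMultiple : ∀ {x y} → Reach (4 * p) T x y → OddMultiple x → OddMultiple y
    Reach-preserves-OddMultiple (here _)         x-odd = x-odd
    Reach-preserves-OddMultiple (step _ x~y y⇝) x-odd =
      Reach-preserves-OddMultiple y⇝ (Adj-preserves-OddMultiple x-odd x~y (Reach-start y⇝))

    T-isVertexCut : ∀ {a} → a ∉ S → OddMultiple a → IsVertexCut (4 * p) T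
    T-isVertexCut {a} a∉S a-odd@(_ , 2∤a) = inj₁ (a , two , ∉S⇒∉T a∉S a≢twoP , two∉T , a↛two)
      where
      a≢twoP : a ≢ twoP
      a≢twoP a≡twoP = 2∤a (subst (λ z → 2 ∣ toℕ z) (sym a≡twoP) 2∣twoP)
      a↛two : ¬ Reach (4 * p) T a two
      a↛two a⇝two = proj₂ (Reach-preserves-OddMultiple a⇝two a-odd) 2∣two

  SmallerVertexCut : Subset (4 * p) → Set
  SmallerVertexCut S = ∃[ T ] (IsVertexCut (4 * p) T × Subset.∣ T ∣ < Subset.∣ S ∣)

  exchange : ∀ {S} → Disconnected (4 * p) S → twoP ∉ S → ∀ {a} → a ∉ S → OddMultiple a
    → SmallerVertexCut S
  exchange disc twoP∉S a∉S a-odd = T , T-isVertexCut a∉S a-odd , ∣T∣<∣S∣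
    where open Exchange disc twoP∉S

  cyclicCut⇒smallerVertexCut : ∀ {S} → IsCyclicVertexCut (4 * p) S → SmallerVertexCut S
  cyclicCut⇒smallerVertexCut cut@(_ , _ , _ , _ , u↛v , u-cycle , v-cycle)
    with cycle⇒nonMultiple⊎twoP (IsCyclicVertexCut⇒Disconnected cut) u-cycle
       | cycle⇒nonMultiple⊎twoP (IsCyclicVertexCut⇒Disconnected cut) v-cycle
  ... | inj₁ u-non | inj₁ v-non =
    ⊥-elim (u↛v (nonMultiples-connected {e = 2} prime[2] p-prime refl u-non v-non))
  ... | inj₂ (twoP∉S , _ , u⇝a , a-odd) | _ =
    exchange (IsCyclicVertexCut⇒Disconnected cut) twoP∉S (Reach-end u⇝a) a-odd
  ... | inj₁ _ | inj₂ (twoP∉S , _ , v⇝a , a-odd) =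
    exchange (IsCyclicVertexCut⇒Disconnected cut) twoP∉S (Reach-end v⇝a) a-odd

mainTheorem4 : (n : ℕ) .{{_ : NonZero n}}
    → (IsPrimePower n ⊎ IsSmallSemiprime n ⊎ IsFourOddPrime n)
    → (k : ℕ) (c : Maybe ℕ)
    → VertexConnectivityIs n k → CyclicVertexConnectivityIs n c
    → c ≢ just k
mainTheorem4 n (inj₁ n-primePower) k .(just k) _ ((_ , cut , _) , _) refl =
  primePower⇒¬Disconnected n-primePower (IsCyclicVertexCut⇒Disconnected cut)
  where open PowerGraph n
mainTheorem4 n (inj₂ (inj₁ n-smallSemiprime)) k .(just k) _ ((_ , cut , _) , _) refl =
  smallSemiprime⇒¬CyclicVertexCut n-smallSemiprime cut
  where open PowerGraph n
mainTheorem4 _ (inj₂ (inj₂ (p , p-prime , p-odd , refl))) k .(just k)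
             (_ , κ≤) ((S , cut , ∣S∣≡k) , _) refl
  with FourTimesOddPrime.cyclicCut⇒smallerVertexCut p-prime p-odd cut
... | T , T-cut , ∣T∣<∣S∣ = <⇒≱ ∣T∣<∣S∣ (subst (_≤ Subset.∣ T ∣) (sym ∣S∣≡k) (κ≤ T T-cut))
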